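{- Every $(\gamma,\varepsilon)$-extractor graph is $4(\gamma+\varepsilon)$-balanced.
   Context: For a bipartite graph $G=(X\uplus Y,E)$ and a distribution $P_X$ on $X$, $G\circ P_X$ is the distribution on $Y$ obtained by sampling $x\sim P_X$ and then a uniformly random neighbor of $x$. The min-entropy of $P$ is $H_\infty(P)=\min_x\log(1/P(x))$, and $d_{TV}(P,Q)=\frac12\sum_x|P(x)-Q(x)|$. A $(\gamma,\varepsilon)$-extractor graph is a bi-regular bipartite graph $G=(X\uplus Y,E)$ such that for every distribution $P_X$ on $X$ with $H_\infty(P_X)\ge\log(\gamma|X|)$ we have $d_{TV}(G\circ P_X,U_Y)\le\varepsilon$, $U_Y$ uniform on $Y$. A graph $G=(V,E)$ (here $V=X\uplus Y$) is $\delta$-balanced if for every partition $V=V_1\cup V_2$ with $|V_1|,|V_2|\le\lceil|V|/2\rceil$ we have $|E[V_1]|+|E[V_2]|\le(1+\delta)|E|/2$, where $E[S]$ is the set of edges with both endpoints in $S$.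
   Formalization: The parameters γ and ε range over the rationals, and the distributions $P_X$ tested in the extractor condition take rational values. -}

module Defs where

open import Data.Bool using (Bool; true; false; if_then_else_)
open import Data.Nat as ℕ using (ℕ; zero; suc; ⌈_/2⌉)
open import Data.Fin using (Fin; zero; suc)
open import Data.Sum using (_⊎_; inj₁; inj₂)
open import Data.Product using (Σ; ∃; _×_; _,_)
open import Data.Integer using (+_)
open import Data.Rational using (ℚ; 0ℚ; 1ℚ; ½; _+_; _-_; _*_; _≤_; ∣_∣; _/_)
open import Relation.Binary.PropositionalEquality using (_≡_)

Σℚ : (k : ℕ) → (Fin k → ℚ) → ℚ
Σℚ zero    f = 0ℚ
Σℚ (suc k) f = f zero + Σℚ k (λ i → f (suc i))

countFin : (k : ℕ) → (Fin k → Bool) → ℕ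
countFin zero    p = 0
countFin (suc k) p = (if p zero then 1 else 0) ℕ.+ countFin k (λ i → p (suc i))

ℕ→ℚ : ℕ → ℚ
ℕ→ℚ k = + k / 1

-- 1/k as a rational (convention: 0 for k = 0; only used when k ≠ 0 matters)
inv : ℕ → ℚ
inv zero    = 0ℚ
inv (suc k) = + 1 / suc k

-- Bipartite graphs G = (X ⊎ Y, E) with X = Fin m, Y = Fin n,
-- given by a (simple) biadjacency relation.

BipGraph : ℕ → ℕ → Set
BipGraph m n = Fin m → Fin n → Bool

degL : ∀ {m n} → BipGraph m n → Fin m → ℕ
degL {n = n} G x = countFin n (λ y → G x y)

degR : ∀ {m n} → BipGraph m n → Fin n → ℕ
degR {m = m} G y = countFin m (λ x → G x y)

Σℕ : (k : ℕ) → (Fin k → ℕ) → ℕ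
Σℕ zero    f = 0
Σℕ (suc k) f = f zero ℕ.+ Σℕ k (λ i → f (suc i))

numEdges : ∀ {m n} → BipGraph m n → ℕ
numEdges {m} G = Σℕ m (degL G)

BiRegular : ∀ {m n} → BipGraph m n → Set
BiRegular G = ∃ λ D → ∃ λ K → (∀ x → degL G x ≡ D) × (∀ y → degR G y ≡ K)

IsDistribution : (k : ℕ) → (Fin k → ℚ) → Set
IsDistribution k P = (∀ i → 0ℚ ≤ P i) × (Σℚ k P ≡ 1ℚ)

-- H∞(P) ≥ log(γ|X|), i.e. P(x) ≤ 1/(γ|X|) for all x
MinEntropyAtLeastLog : (m : ℕ) → (P : Fin m → ℚ) → (γ : ℚ) → Set
MinEntropyAtLeastLog m P γ = ∀ x → P x * (γ * ℕ→ℚ m) ≤ 1ℚ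

bval : Bool → ℚ
bval true  = 1ℚ
bval false = 0ℚ

_∘ᴳ_ : ∀ {m n} → BipGraph m n → (Fin m → ℚ) → (Fin n → ℚ)
_∘ᴳ_ {m} G P y = Σℚ m (λ x → P x * bval (G x y) * inv (degL G x))

uniform : (n : ℕ) → Fin n → ℚ
uniform n _ = inv n

dTV : (k : ℕ) → (Fin k → ℚ) → (Fin k → ℚ) → ℚ
dTV k P Q = ½ * Σℚ k (λ i → ∣ P i - Q i ∣)

IsExtractor : ∀ {m n} → BipGraph m n → ℚ → ℚ → Set
IsExtractor {m} {n} G γ ε =
  BiRegular G ×
  (∀ (P : Fin m → ℚ) → IsDistribution m P → MinEntropyAtLeastLog m P γ →
     dTV n (G ∘ᴳ P) (uniform n) ≤ ε)

-- δ-balanced.  A partition V = V₁ ∪ V₂ of V = X ⊎ Y is a map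
-- side : X ⊎ Y → Bool  (V₁ = side⁻¹ true, V₂ = side⁻¹ false).

sizeSide : ∀ {m n} → (Fin m ⊎ Fin n → Bool) → Bool → ℕ
sizeSide {m} {n} side b =
  countFin m (λ x → side (inj₁ x) ≡ᵇᵇ b) ℕ.+ countFin n (λ y → side (inj₂ y) ≡ᵇᵇ b)
  where
    _≡ᵇᵇ_ : Bool → Bool → Bool
    true  ≡ᵇᵇ true  = true
    false ≡ᵇᵇ false = true
    _     ≡ᵇᵇ _     = false

sameSide : Bool → Bool → Bool
sameSide true  true  = true
sameSide false false = true
sameSide _     _     = false

internalEdges : ∀ {m n} → BipGraph m n → (Fin m ⊎ Fin n → Bool) → ℕ
internalEdges {m} {n} G side =
  Σℕ m (λ x → countFin n (λ y → G x y ∧ sameSide (side (inj₁ x)) (side (inj₂ y))))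
  where
    _∧_ : Bool → Bool → Bool
    true  ∧ b = b
    false ∧ _ = false

IsBalanced : ∀ {m n} → BipGraph m n → ℚ → Set
IsBalanced {m} {n} G δ =
  ∀ (side : Fin m ⊎ Fin n → Bool) →
    sizeSide side true ℕ.≤ ⌈ m ℕ.+ n /2⌉ →
    sizeSide side false ℕ.≤ ⌈ m ℕ.+ n /2⌉ →
    ℕ→ℚ (internalEdges G side) ≤ (1ℚ + δ) * ℕ→ℚ (numEdges G) * ½

-- Write the two parts as V₁ = S₁ ∪ T₁ and V₂ = S₂ ∪ T₂ with Sᵢ ⊆ X, Tᵢ ⊆ Y, and let D be
-- the left degree.  If |Sᵢ| ≥ γ|X|, the uniform distribution on Sᵢ has enough min-entropy,
-- so its image under G is ε-close to uniform; as that image gives Tᵢ the mass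
-- e(Sᵢ,Tᵢ)/(D|Sᵢ|), this yields e(Sᵢ,Tᵢ) ≤ D|Sᵢ|(|Tᵢ|/|Y| + 2ε).  Otherwise simply
-- e(Sᵢ,Tᵢ) ≤ D|Sᵢ| ≤ γD|X|.  Summing, |E[V₁]| + |E[V₂]| ≤ D(|S₁||T₁| + |S₂||T₂|)/|Y| + 2(γ+ε)|E|.
-- Since neither part has more than half of the vertices, S₁ and T₁ cannot both be larger
-- than S₂ and T₂, and the rearrangement inequality then gives |S₁||T₁| + |S₂||T₂| ≤ |X||Y|/2.

module Submission where

open import Data.Bool using (Bool; true; false; not; _∧_; if_then_else_)
open import Data.Fin using (Fin; zero; suc)
open import Data.Integer as ℤ using (+_)
import Data.Integer.Properties as ℤₚ
open import Data.Nat as ℕ using (ℕ; zero; suc; ⌈_/2⌉; ⌊_/2⌋; z≤n; s≤s; NonZero)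
import Data.Nat.Coprimality as Coprime
import Data.Nat.Properties as ℕₚ
open import Data.Nat.Tactic.RingSolver using () renaming (ring to ℕ-ring)
open import Data.Product using (_×_; _,_; proj₂)
open import Data.Sum using (_⊎_; inj₁; inj₂; [_,_]′)
open import Function using (_∘_)
open import Level using (0ℓ)
open import Relation.Binary.PropositionalEquality
open import Relation.Nullary using (¬_; Dec; yes; no; contradiction)
open import Relation.Nullary.Decidable using (dec⇒maybe)
open import Tactic.RingSolver using (solve-∀)
open import Tactic.RingSolver.Core.AlmostCommutativeRing using (AlmostCommutativeRing; fromCommutativeRing)

open import Defs

module _ where
  open import Data.Nat using (_+_; _*_; _≤_; _<_)
  open ℕₚ

  ⌈n/2⌉≤1+⌊n/2⌋ : ∀ n → ⌈ n /2⌉ ≤ suc ⌊ n /2⌋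
  ⌈n/2⌉≤1+⌊n/2⌋ zero          = z≤n
  ⌈n/2⌉≤1+⌊n/2⌋ (suc zero)    = s≤s z≤n
  ⌈n/2⌉≤1+⌊n/2⌋ (suc (suc n)) = s≤s (⌈n/2⌉≤1+⌊n/2⌋ n)

  m≤⌈m+n/2⌉⇒m≤1+n : ∀ m n → m ≤ ⌈ m + n /2⌉ → m ≤ suc n
  m≤⌈m+n/2⌉⇒m≤1+n m n m≤half = ≤-trans m≤half (≤-trans (⌈n/2⌉≤1+⌊n/2⌋ (m + n)) (s≤s ⌊m+n/2⌋≤n))
    where
    open ≤-Reasoning
    ⌊m+n/2⌋≤n : ⌊ m + n /2⌋ ≤ n
    ⌊m+n/2⌋≤n = +-cancelʳ-≤ m _ _ (begin
      ⌊ m + n /2⌋ + m           ≤⟨ +-monoʳ-≤ ⌊ m + n /2⌋ m≤half ⟩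
      ⌊ m + n /2⌋ + ⌈ m + n /2⌉ ≡⟨ ⌊n/2⌋+⌈n/2⌉≡n (m + n) ⟩
      m + n                     ≡⟨ +-comm m n ⟩
      n + m                     ∎)

  ¬both-smaller : ∀ {a a′ b b′} → a + b ≤ ⌈ (a + a′) + (b + b′) /2⌉ → ¬ (a′ < a × b′ < b)
  ¬both-smaller {a} {a′} {b} {b′} balanced (a′<a , b′<b) =
    <-irrefl refl (≤-trans 2+a′+b′≤a+b (m≤⌈m+n/2⌉⇒m≤1+n (a + b) (a′ + b′) balanced′))
    where
    regroup : ∀ a a′ b b′ → (a + a′) + (b + b′) ≡ (a + b) + (a′ + b′)
    regroup = solve-∀ ℕ-ring
    balanced′ : a + b ≤ ⌈ (a + b) + (a′ + b′) /2⌉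
    balanced′ = subst (λ N → a + b ≤ ⌈ N /2⌉) (regroup a a′ b b′) balanced
    2+a′+b′≤a+b : suc (suc (a′ + b′)) ≤ a + b
    2+a′+b′≤a+b = subst (_≤ a + b) (cong suc (+-suc a′ b′)) (+-mono-≤ a′<a b′<b)

  rearrangement : ∀ {a a′ b b′} → a′ ≤ a → b ≤ b′ → a * b + a′ * b′ ≤ a * b′ + a′ * b
  rearrangement {a′ = a′} {b = b} a′≤a b≤b′ with m≤n⇒∃[o]m+o≡n a′≤a | m≤n⇒∃[o]m+o≡n b≤b′
  ... | p , refl | q , refl = ≤-trans (m≤m+n _ (p * q)) (≤-reflexive (expand a′ p b q))
    where
    expand : ∀ a′ p b q → ((a′ + p) * b + a′ * (b + q)) + p * q ≡ (a′ + p) * (b + q) + a′ * b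
    expand = solve-∀ ℕ-ring

  cross-≤ : ∀ {a a′ b b′} → a′ ≤ a → ¬ (a′ < a × b′ < b) → a * b + a′ * b′ ≤ a * b′ + a′ * b
  cross-≤ {a} {b = b} {b′} a′≤a not-both with ≤-total b b′
  ... | inj₁ b≤b′ = rearrangement a′≤a b≤b′
  ... | inj₂ b′≤b with m≤n⇒m<n∨m≡n a′≤a | m≤n⇒m<n∨m≡n b′≤b
  ...   | inj₁ a′<a | inj₁ b′<b = contradiction (a′<a , b′<b) not-both
  ...   | inj₁ _    | inj₂ refl = ≤-refl
  ...   | inj₂ refl | _         = ≤-reflexive (+-comm (a * b) (a * b′))

  balanced-split : ∀ {a a′ b b′} →
                   a + b ≤ ⌈ (a + a′) + (b + b′) /2⌉ → a′ + b′ ≤ ⌈ (a + a′) + (b + b′) /2⌉ →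
                   2 * (a * b + a′ * b′) ≤ (a + a′) * (b + b′)
  balanced-split {a} {a′} {b} {b′} balanced balanced′ = begin
    2 * (a * b + a′ * b′)                     ≡⟨ double (a * b + a′ * b′) ⟩
    (a * b + a′ * b′) + (a * b + a′ * b′)     ≤⟨ +-monoʳ-≤ (a * b + a′ * b′) cross ⟩
    (a * b + a′ * b′) + (a * b′ + a′ * b)     ≡⟨ expand a a′ b b′ ⟩
    (a + a′) * (b + b′)                       ∎
    where
    open ≤-Reasoning
    double : ∀ x → 2 * x ≡ x + x
    double = solve-∀ ℕ-ring
    expand : ∀ a a′ b b′ → (a * b + a′ * b′) + (a * b′ + a′ * b) ≡ (a + a′) * (b + b′)
    expand = solve-∀ ℕ-ring
    cross : a * b + a′ * b′ ≤ a * b′ + a′ * b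
    cross with ≤-total a′ a
    ... | inj₁ a′≤a = cross-≤ a′≤a (¬both-smaller balanced)
    ... | inj₂ a≤a′ = subst₂ _≤_ (+-comm (a′ * b′) (a * b)) (+-comm (a′ * b) (a * b′))
                        (cross-≤ a≤a′ (¬both-smaller swapped′))
      where
      swapped′ : a′ + b′ ≤ ⌈ (a′ + a) + (b′ + b) /2⌉
      swapped′ = subst (λ N → a′ + b′ ≤ ⌈ N /2⌉) (cong₂ _+_ (+-comm a a′) (+-comm b b′)) balanced′

open import Data.Rational hiding (NonZero)
open import Data.Rational.Properties

ℚ-ring : AlmostCommutativeRing 0ℓ 0ℓ
ℚ-ring = fromCommutativeRing +-*-commutativeRing (λ x → dec⇒maybe (0ℚ ≟ x))

ℕ→ℚ≡mkℚ : ∀ k → ℕ→ℚ k ≡ mkℚ (+ k) 0 (Coprime.sym (Coprime.1-coprimeTo k))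
ℕ→ℚ≡mkℚ k = normalize-coprime (Coprime.sym (Coprime.1-coprimeTo k))

ℕ→ℚ-+ : ∀ a b → ℕ→ℚ (a ℕ.+ b) ≡ ℕ→ℚ a + ℕ→ℚ b
ℕ→ℚ-+ a b = sym (trans (cong₂ _+_ (ℕ→ℚ≡mkℚ a) (ℕ→ℚ≡mkℚ b)) sum)
  where
  sum : mkℚ (+ a) 0 (Coprime.sym (Coprime.1-coprimeTo a)) + mkℚ (+ b) 0 (Coprime.sym (Coprime.1-coprimeTo b))
        ≡ ℕ→ℚ (a ℕ.+ b)
  sum rewrite ℕₚ.*-identityʳ a | ℕₚ.*-identityʳ b | ℤₚ.+◃n≡+n a | ℤₚ.+◃n≡+n b = refl

ℕ→ℚ-* : ∀ a b → ℕ→ℚ (a ℕ.* b) ≡ ℕ→ℚ a * ℕ→ℚ b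
ℕ→ℚ-* a b = sym (trans (cong₂ _*_ (ℕ→ℚ≡mkℚ a) (ℕ→ℚ≡mkℚ b)) product)
  where
  product : mkℚ (+ a) 0 (Coprime.sym (Coprime.1-coprimeTo a)) * mkℚ (+ b) 0 (Coprime.sym (Coprime.1-coprimeTo b))
            ≡ ℕ→ℚ (a ℕ.* b)
  product rewrite ℤₚ.+◃n≡+n (a ℕ.* b) = refl

ℕ→ℚ-mono-≤ : ∀ {a b} → a ℕ.≤ b → ℕ→ℚ a ≤ ℕ→ℚ b
ℕ→ℚ-mono-≤ {a} {b} a≤b rewrite ℕ→ℚ≡mkℚ a | ℕ→ℚ≡mkℚ b =
  *≤* (subst₂ ℤ._≤_ (sym (ℤₚ.*-identityʳ (+ a))) (sym (ℤₚ.*-identityʳ (+ b))) (ℤ.+≤+ a≤b))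

0≤ℕ→ℚ : ∀ k → 0ℚ ≤ ℕ→ℚ k
0≤ℕ→ℚ k = nonNegative⁻¹ _ {{normalize-nonNeg k 1}}

ℕ→ℚ-pos⇒nonZero : ∀ k → 0ℚ < ℕ→ℚ k → NonZero k
ℕ→ℚ-pos⇒nonZero zero    0<0 = contradiction 0<0 (<-irrefl refl)
ℕ→ℚ-pos⇒nonZero (suc k) _   = _

0≤inv : ∀ k → 0ℚ ≤ inv k
0≤inv zero    = ≤-refl
0≤inv (suc k) = nonNegative⁻¹ _ {{normalize-nonNeg 1 (suc k)}}

ℕ→ℚ-*-inv : ∀ k .{{_ : NonZero k}} → ℕ→ℚ k * inv k ≡ 1ℚ
ℕ→ℚ-*-inv (suc k) rewrite ℕ→ℚ≡mkℚ (suc k) | normalize-coprime (Coprime.1-coprimeTo (suc k)) =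
  *-inverseʳ (mkℚ (+ suc k) 0 (Coprime.sym (Coprime.1-coprimeTo (suc k))))

ℕ→ℚ-*-inv-cancel : ∀ a b .{{_ : NonZero a}} .{{_ : NonZero b}} x →
                   ℕ→ℚ a * ℕ→ℚ b * (inv a * inv b * x) ≡ x
ℕ→ℚ-*-inv-cancel a b x = begin
  ℕ→ℚ a * ℕ→ℚ b * (inv a * inv b * x)       ≡⟨ regroup (ℕ→ℚ a) (ℕ→ℚ b) (inv a) (inv b) x ⟩
  (ℕ→ℚ a * inv a) * (ℕ→ℚ b * inv b) * x     ≡⟨ cong₂ (λ u v → u * v * x) (ℕ→ℚ-*-inv a) (ℕ→ℚ-*-inv b) ⟩
  1ℚ * 1ℚ * x                               ≡⟨ *-identityˡ x ⟩
  x                                         ∎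
  where
  open ≡-Reasoning
  regroup : ∀ a b i j x → a * b * (i * j * x) ≡ (a * i) * (b * j) * x
  regroup = solve-∀ ℚ-ring

0≤½ : 0ℚ ≤ ½
0≤½ = *≤* (ℤ.+≤+ z≤n)

0≤bval : ∀ a → 0ℚ ≤ bval a
0≤bval true  = *≤* (ℤ.+≤+ z≤n)
0≤bval false = ≤-refl

bval≤1 : ∀ a → bval a ≤ 1ℚ
bval≤1 true  = ≤-refl
bval≤1 false = 0≤bval true

p≤∣p∣ : ∀ p → p ≤ ∣ p ∣
p≤∣p∣ (mkℚ (+ n) d c)            = ≤-refl
p≤∣p∣ p@(mkℚ ℤ.-[1+ n ] d c) = ≤-trans (<⇒≤ (negative⁻¹ p)) (0≤∣p∣ p)

nonNeg-+ : ∀ {p q} → 0ℚ ≤ p → 0ℚ ≤ q → 0ℚ ≤ p + q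
nonNeg-+ = +-mono-≤

nonNeg-* : ∀ {p q} → 0ℚ ≤ p → 0ℚ ≤ q → 0ℚ ≤ p * q
nonNeg-* {p} {q} 0≤p 0≤q =
  nonNegative⁻¹ (p * q) {{nonNeg*nonNeg⇒nonNeg p {{nonNegative 0≤p}} q {{nonNegative 0≤q}}}}

*-monoˡ-≤-nonNeg′ : ∀ {r p q} → 0ℚ ≤ r → p ≤ q → r * p ≤ r * q
*-monoˡ-≤-nonNeg′ {r} 0≤r = *-monoˡ-≤-nonNeg r {{nonNegative 0≤r}}

*-monoʳ-≤-nonNeg′ : ∀ {r p q} → 0ℚ ≤ r → p ≤ q → p * r ≤ q * r
*-monoʳ-≤-nonNeg′ {r} 0≤r = *-monoʳ-≤-nonNeg r {{nonNegative 0≤r}}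

p≤p+q : ∀ {p q} → 0ℚ ≤ q → p ≤ p + q
p≤p+q {p} {q} 0≤q = subst (_≤ p + q) (+-identityʳ p) (+-monoʳ-≤ p 0≤q)

p≤q+p : ∀ {p q} → 0ℚ ≤ q → p ≤ q + p
p≤q+p {p} {q} 0≤q = subst (_≤ q + p) (+-identityˡ p) (+-monoˡ-≤ p 0≤q)

Σℚ-cong : ∀ k {f g : Fin k → ℚ} → (∀ i → f i ≡ g i) → Σℚ k f ≡ Σℚ k g
Σℚ-cong zero    f≗g = refl
Σℚ-cong (suc k) f≗g = cong₂ _+_ (f≗g zero) (Σℚ-cong k (f≗g ∘ suc))

Σℚ-mono-≤ : ∀ k {f g : Fin k → ℚ} → (∀ i → f i ≤ g i) → Σℚ k f ≤ Σℚ k g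
Σℚ-mono-≤ zero    f≤g = ≤-refl
Σℚ-mono-≤ (suc k) f≤g = +-mono-≤ (f≤g zero) (Σℚ-mono-≤ k (f≤g ∘ suc))

Σℚ-0 : ∀ k → Σℚ k (λ _ → 0ℚ) ≡ 0ℚ
Σℚ-0 zero    = refl
Σℚ-0 (suc k) = cong (_+_ 0ℚ) (Σℚ-0 k)

Σℚ-distrib-+ : ∀ k (f g : Fin k → ℚ) → Σℚ k (λ i → f i + g i) ≡ Σℚ k f + Σℚ k g
Σℚ-distrib-+ zero    f g = refl
Σℚ-distrib-+ (suc k) f g =
  trans (cong (_+_ (f zero + g zero)) (Σℚ-distrib-+ k (f ∘ suc) (g ∘ suc)))
        (interchange (f zero) (g zero) (Σℚ k (f ∘ suc)) (Σℚ k (g ∘ suc)))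
  where
  interchange : ∀ a b c d → (a + b) + (c + d) ≡ (a + c) + (b + d)
  interchange = solve-∀ ℚ-ring

*-distribˡ-Σℚ : ∀ k c (f : Fin k → ℚ) → c * Σℚ k f ≡ Σℚ k (λ i → c * f i)
*-distribˡ-Σℚ zero    c f = *-zeroʳ c
*-distribˡ-Σℚ (suc k) c f = trans (*-distribˡ-+ c (f zero) _) (cong (_+_ (c * f zero)) (*-distribˡ-Σℚ k c (f ∘ suc)))

*-distribʳ-Σℚ : ∀ k c (f : Fin k → ℚ) → Σℚ k f * c ≡ Σℚ k (λ i → f i * c)
*-distribʳ-Σℚ zero    c f = *-zeroˡ c
*-distribʳ-Σℚ (suc k) c f = trans (*-distribʳ-+ c (f zero) _) (cong (_+_ (f zero * c)) (*-distribʳ-Σℚ k c (f ∘ suc)))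

Σℚ-comm : ∀ m n (f : Fin m → Fin n → ℚ) → Σℚ m (λ x → Σℚ n (f x)) ≡ Σℚ n (λ y → Σℚ m (λ x → f x y))
Σℚ-comm zero    n f = sym (Σℚ-0 n)
Σℚ-comm (suc m) n f =
  trans (cong (_+_ (Σℚ n (f zero))) (Σℚ-comm m n (f ∘ suc)))
        (sym (Σℚ-distrib-+ n (f zero) (λ y → Σℚ m (λ x → f (suc x) y))))

Σℚ-bval : ∀ k (p : Fin k → Bool) → Σℚ k (λ i → bval (p i)) ≡ ℕ→ℚ (countFin k p)
Σℚ-bval zero    p = refl
Σℚ-bval (suc k) p with p zero
... | true  = trans (cong (_+_ 1ℚ) (Σℚ-bval k (p ∘ suc))) (sym (ℕ→ℚ-+ 1 (countFin k (p ∘ suc))))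
... | false = trans (+-identityˡ _) (Σℚ-bval k (p ∘ suc))

Σℚ-ℕ→ℚ : ∀ k (f : Fin k → ℕ) → Σℚ k (λ i → ℕ→ℚ (f i)) ≡ ℕ→ℚ (Σℕ k f)
Σℚ-ℕ→ℚ zero    f = refl
Σℚ-ℕ→ℚ (suc k) f =
  trans (cong (_+_ (ℕ→ℚ (f zero))) (Σℚ-ℕ→ℚ k (f ∘ suc))) (sym (ℕ→ℚ-+ (f zero) (Σℕ k (f ∘ suc))))

Σℕ-cong : ∀ k {f g : Fin k → ℕ} → (∀ i → f i ≡ g i) → Σℕ k f ≡ Σℕ k g
Σℕ-cong zero    f≗g = refl
Σℕ-cong (suc k) f≗g = cong₂ ℕ._+_ (f≗g zero) (Σℕ-cong k (f≗g ∘ suc))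

Σℕ-const : ∀ k {f : Fin k → ℕ} {c} → (∀ i → f i ≡ c) → Σℕ k f ≡ k ℕ.* c
Σℕ-const zero    f≗c = refl
Σℕ-const (suc k) f≗c = cong₂ ℕ._+_ (f≗c zero) (Σℕ-const k (f≗c ∘ suc))

countFin-cong : ∀ k {p q : Fin k → Bool} → (∀ i → p i ≡ q i) → countFin k p ≡ countFin k q
countFin-cong zero    p≗q = refl
countFin-cong (suc k) p≗q = cong₂ ℕ._+_ (cong (λ b → if b then 1 else 0) (p≗q zero)) (countFin-cong k (p≗q ∘ suc))

countFin-complement : ∀ k (p : Fin k → Bool) → countFin k p ℕ.+ countFin k (not ∘ p) ≡ k
countFin-complement zero    p = refl
countFin-complement (suc k) p with p zero
... | true  = cong suc (countFin-complement k (p ∘ suc))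
... | false = trans (ℕₚ.+-suc (countFin k (p ∘ suc)) _) (cong suc (countFin-complement k (p ∘ suc)))

size : ∀ {k} → (Fin k → Bool) → ℚ
size {k} S = ℕ→ℚ (countFin k S)

mass : ∀ {k} → (Fin k → Bool) → (Fin k → ℚ) → ℚ
mass {k} T P = Σℚ k (λ i → bval (T i) * P i)

uniformOn : ∀ {k} → (Fin k → Bool) → Fin k → ℚ
uniformOn {k} S i = bval (S i) * inv (countFin k S)

0≤uniformOn : ∀ {k} (S : Fin k → Bool) i → 0ℚ ≤ uniformOn S i
0≤uniformOn {k} S i = nonNeg-* (0≤bval (S i)) (0≤inv (countFin k S))

uniformOn-isDistribution : ∀ {k} (S : Fin k → Bool) .{{_ : NonZero (countFin k S)}} →
                           IsDistribution k (uniformOn S)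
uniformOn-isDistribution {k} S = 0≤uniformOn S , (begin
  Σℚ k (uniformOn S)                      ≡⟨ *-distribʳ-Σℚ k (inv (countFin k S)) (bval ∘ S) ⟨
  Σℚ k (bval ∘ S) * inv (countFin k S)    ≡⟨ cong (_* inv (countFin k S)) (Σℚ-bval k S) ⟩
  size S * inv (countFin k S)             ≡⟨ ℕ→ℚ-*-inv (countFin k S) ⟩
  1ℚ                                      ∎)
  where open ≡-Reasoning

uniformOn-minEntropy : ∀ {k} (S : Fin k → Bool) .{{_ : NonZero (countFin k S)}} {γ} →
                       γ * ℕ→ℚ k ≤ size S → MinEntropyAtLeastLog k (uniformOn S) γ
uniformOn-minEntropy {k} S {γ} γk≤|S| x = begin
  uniformOn S x * (γ * ℕ→ℚ k)     ≤⟨ *-monoˡ-≤-nonNeg′ (0≤uniformOn S x) γk≤|S| ⟩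
  bval (S x) * i * size S         ≡⟨ *-assoc (bval (S x)) i (size S) ⟩
  bval (S x) * (i * size S)       ≡⟨ cong (bval (S x) *_) (trans (*-comm i (size S)) (ℕ→ℚ-*-inv (countFin k S))) ⟩
  bval (S x) * 1ℚ                 ≡⟨ *-identityʳ (bval (S x)) ⟩
  bval (S x)                      ≤⟨ bval≤1 (S x) ⟩
  1ℚ                              ∎
  where
  open ≤-Reasoning
  i : ℚ
  i = inv (countFin k S)

mass-uniform : ∀ {k} (T : Fin k → Bool) → mass T (uniform k) ≡ size T * inv k
mass-uniform {k} T = trans (sym (*-distribʳ-Σℚ k (inv k) (bval ∘ T))) (cong (_* inv k) (Σℚ-bval k T))

bval*p≤bval*q+∣p-q∣ : ∀ a p q → bval a * p ≤ bval a * q + ∣ p - q ∣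
bval*p≤bval*q+∣p-q∣ true p q = begin
  1ℚ * p               ≡⟨ split p q ⟩
  1ℚ * q + (p - q)     ≤⟨ +-monoʳ-≤ (1ℚ * q) (p≤∣p∣ (p - q)) ⟩
  1ℚ * q + ∣ p - q ∣   ∎
  where
  open ≤-Reasoning
  split : ∀ p q → 1ℚ * p ≡ 1ℚ * q + (p - q)
  split = solve-∀ ℚ-ring
bval*p≤bval*q+∣p-q∣ false p q = begin
  0ℚ * p               ≡⟨ vanish p q ⟩
  0ℚ * q + 0ℚ          ≤⟨ +-monoʳ-≤ (0ℚ * q) (0≤∣p∣ (p - q)) ⟩
  0ℚ * q + ∣ p - q ∣   ∎
  where
  open ≤-Reasoning
  vanish : ∀ p q → 0ℚ * p ≡ 0ℚ * q + 0ℚ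
  vanish = solve-∀ ℚ-ring

-- Holds for arbitrary P and Q; for two distributions the factor 2 could be dropped.
mass-≤-dTV : ∀ {k} (T : Fin k → Bool) (P Q : Fin k → ℚ) → mass T P ≤ mass T Q + (+ 2 / 1) * dTV k P Q
mass-≤-dTV {k} T P Q = begin
  mass T P                                            ≤⟨ Σℚ-mono-≤ k (λ i → bval*p≤bval*q+∣p-q∣ (T i) (P i) (Q i)) ⟩
  Σℚ k (λ i → bval (T i) * Q i + ∣ P i - Q i ∣)       ≡⟨ Σℚ-distrib-+ k (λ i → bval (T i) * Q i) (λ i → ∣ P i - Q i ∣) ⟩
  mass T Q + Σℚ k (λ i → ∣ P i - Q i ∣)               ≡⟨ cong (_+_ (mass T Q)) (twice-half _) ⟩
  mass T Q + (+ 2 / 1) * dTV k P Q                    ∎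
  where
  open ≤-Reasoning
  twice-half : ∀ x → x ≡ (+ 2 / 1) * (½ * x)
  twice-half = solve-∀ ℚ-ring

edgesBetween : ∀ {m n} → BipGraph m n → (Fin m → Bool) → (Fin n → Bool) → ℚ
edgesBetween {m} {n} G S T = Σℚ m (λ x → Σℚ n (λ y → bval (S x) * bval (T y) * bval (G x y)))

numEdges-regular : ∀ {m n} (G : BipGraph m n) {D} → (∀ x → degL G x ≡ D) →
                   ℕ→ℚ (numEdges G) ≡ ℕ→ℚ m * ℕ→ℚ D
numEdges-regular {m} G {D} regular = trans (cong ℕ→ℚ (Σℕ-const m regular)) (ℕ→ℚ-* m D)

edgesBetween-≤ : ∀ {m n} {G : BipGraph m n} {D} → (∀ x → degL G x ≡ D) →
                 ∀ S T → edgesBetween G S T ≤ size S * ℕ→ℚ D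
edgesBetween-≤ {m} {n} {G} {D} regular S T = begin
  edgesBetween G S T                                ≤⟨ Σℚ-mono-≤ m (λ x → Σℚ-mono-≤ n (λ y → drop-T x y)) ⟩
  Σℚ m (λ x → Σℚ n (λ y → bval (S x) * bval (G x y)))  ≡⟨ Σℚ-cong m (λ x → *-distribˡ-Σℚ n (bval (S x)) (bval ∘ G x)) ⟨
  Σℚ m (λ x → bval (S x) * Σℚ n (bval ∘ G x))          ≡⟨ Σℚ-cong m (λ x → cong (bval (S x) *_) (degree x)) ⟩
  Σℚ m (λ x → bval (S x) * ℕ→ℚ D)                     ≡⟨ *-distribʳ-Σℚ m (ℕ→ℚ D) (bval ∘ S) ⟨
  Σℚ m (bval ∘ S) * ℕ→ℚ D                             ≡⟨ cong (_* ℕ→ℚ D) (Σℚ-bval m S) ⟩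
  size S * ℕ→ℚ D                                     ∎
  where
  open ≤-Reasoning
  drop-T : ∀ x y → bval (S x) * bval (T y) * bval (G x y) ≤ bval (S x) * bval (G x y)
  drop-T x y with T y
  ... | true  = ≤-reflexive (cong (_* bval (G x y)) (*-identityʳ (bval (S x))))
  ... | false = ≤-trans (≤-reflexive (trans (cong (_* bval (G x y)) (*-zeroʳ (bval (S x)))) (*-zeroˡ (bval (G x y)))))
                        (nonNeg-* (0≤bval (S x)) (0≤bval (G x y)))
  degree : ∀ x → Σℚ n (bval ∘ G x) ≡ ℕ→ℚ D
  degree x = trans (Σℚ-bval n (G x)) (cong ℕ→ℚ (regular x))

mass-∘ᴳ-uniformOn : ∀ {m n} {G : BipGraph m n} {D} → (∀ x → degL G x ≡ D) →
                    ∀ S T → mass T (G ∘ᴳ uniformOn S) ≡ inv (countFin m S) * inv D * edgesBetween G S T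
mass-∘ᴳ-uniformOn {m} {n} {G} {D} regular S T = begin
  Σℚ n (λ y → bval (T y) * Σℚ m (λ x → uniformOn S x * bval (G x y) * inv (degL G x)))
    ≡⟨ Σℚ-cong n (λ y → *-distribˡ-Σℚ m (bval (T y)) _) ⟩
  Σℚ n (λ y → Σℚ m (λ x → bval (T y) * (uniformOn S x * bval (G x y) * inv (degL G x))))
    ≡⟨ Σℚ-cong n (λ y → Σℚ-cong m (λ x → factor x y)) ⟩
  Σℚ n (λ y → Σℚ m (λ x → c * (bval (S x) * bval (T y) * bval (G x y))))
    ≡⟨ Σℚ-comm m n (λ x y → c * (bval (S x) * bval (T y) * bval (G x y))) ⟨
  Σℚ m (λ x → Σℚ n (λ y → c * (bval (S x) * bval (T y) * bval (G x y))))
    ≡⟨ Σℚ-cong m (λ x → *-distribˡ-Σℚ n c _) ⟨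
  Σℚ m (λ x → c * Σℚ n (λ y → bval (S x) * bval (T y) * bval (G x y)))
    ≡⟨ *-distribˡ-Σℚ m c _ ⟨
  c * edgesBetween G S T
    ∎
  where
  open ≡-Reasoning
  c : ℚ
  c = inv (countFin m S) * inv D
  reorder : ∀ t s i g j → t * (s * i * g * j) ≡ i * j * (s * t * g)
  reorder = solve-∀ ℚ-ring
  factor : ∀ x y → bval (T y) * (uniformOn S x * bval (G x y) * inv (degL G x)) ≡ c * (bval (S x) * bval (T y) * bval (G x y))
  factor x y = trans (cong (λ d → bval (T y) * (uniformOn S x * bval (G x y) * inv d)) (regular x))
                     (reorder (bval (T y)) (bval (S x)) (inv (countFin m S)) (bval (G x y)) (inv D))

sideX : ∀ {m n} → (Fin m ⊎ Fin n → Bool) → Bool → Fin m → Bool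
sideX side true  = side ∘ inj₁
sideX side false = not ∘ side ∘ inj₁

sideY : ∀ {m n} → (Fin m ⊎ Fin n → Bool) → Bool → Fin n → Bool
sideY side true  = side ∘ inj₂
sideY side false = not ∘ side ∘ inj₂

-- sizeSide and internalEdges use Boolean connectives local to their where-blocks
-- in Defs.  The refl in the types below makes Agda instantiate the placeholders
-- with those local functions, so that they can be evaluated by matching.
private
  SideTestAgrees : ∀ {m n} (side : Fin m ⊎ Fin n → Bool) b (p : Fin m → Bool) (q : Fin n → Bool) →
                   sizeSide side b ≡ countFin m p ℕ.+ countFin n q → Set
  SideTestAgrees side b p q _ = ∀ v → [ p , q ]′ v ≡ [ sideX side b , sideY side b ]′ v

  sideTestAgrees : ∀ {m n} (side : Fin m ⊎ Fin n → Bool) b → SideTestAgrees side b _ _ refl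
  sideTestAgrees side true  (inj₁ x) with side (inj₁ x)
  ... | true  = refl
  ... | false = refl
  sideTestAgrees side false (inj₁ x) with side (inj₁ x)
  ... | true  = refl
  ... | false = refl
  sideTestAgrees side true  (inj₂ y) with side (inj₂ y)
  ... | true  = refl
  ... | false = refl
  sideTestAgrees side false (inj₂ y) with side (inj₂ y)
  ... | true  = refl
  ... | false = refl

  ConjunctionAgrees : ∀ {m n} (G : BipGraph m n) side (F : Fin m → Fin n → Bool) →
                      internalEdges G side ≡ Σℕ m (λ x → countFin n (F x)) → Set
  ConjunctionAgrees G side F _ = ∀ x y → F x y ≡ (G x y ∧ sameSide (side (inj₁ x)) (side (inj₂ y)))

  conjunctionAgrees : ∀ {m n} (G : BipGraph m n) side → ConjunctionAgrees G side _ refl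
  conjunctionAgrees G side x y with G x y
  ... | true  = refl
  ... | false = refl

sizeSide-≡ : ∀ {m n} (side : Fin m ⊎ Fin n → Bool) b →
             sizeSide side b ≡ countFin m (sideX side b) ℕ.+ countFin n (sideY side b)
sizeSide-≡ {m} {n} side b =
  cong₂ ℕ._+_ (countFin-cong m (sideTestAgrees side b ∘ inj₁)) (countFin-cong n (sideTestAgrees side b ∘ inj₂))

internalEdges-∧ : ∀ {m n} (G : BipGraph m n) side →
                  internalEdges G side
                    ≡ Σℕ m (λ x → countFin n (λ y → G x y ∧ sameSide (side (inj₁ x)) (side (inj₂ y))))
internalEdges-∧ {m} {n} G side = Σℕ-cong m (λ x → countFin-cong n (conjunctionAgrees G side x))

bval-∧-sameSide : ∀ g a c → bval (g ∧ sameSide a c) ≡ bval a * bval c * bval g + bval (not a) * bval (not c) * bval g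
bval-∧-sameSide true  true  true  = refl
bval-∧-sameSide true  true  false = refl
bval-∧-sameSide true  false true  = refl
bval-∧-sameSide true  false false = refl
bval-∧-sameSide false true  true  = refl
bval-∧-sameSide false true  false = refl
bval-∧-sameSide false false true  = refl
bval-∧-sameSide false false false = refl

internalEdges-split : ∀ {m n} (G : BipGraph m n) side →
                      ℕ→ℚ (internalEdges G side)
                        ≡ edgesBetween G (sideX side true) (sideY side true) + edgesBetween G (sideX side false) (sideY side false)
internalEdges-split {m} {n} G side = begin
  ℕ→ℚ (internalEdges G side)
    ≡⟨ cong ℕ→ℚ (internalEdges-∧ G side) ⟩
  ℕ→ℚ (Σℕ m (λ x → countFin n (λ y → G x y ∧ sameSide (a x) (c y))))
    ≡⟨ Σℚ-ℕ→ℚ m _ ⟨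
  Σℚ m (λ x → ℕ→ℚ (countFin n (λ y → G x y ∧ sameSide (a x) (c y))))
    ≡⟨ Σℚ-cong m (λ x → Σℚ-bval n _) ⟨
  Σℚ m (λ x → Σℚ n (λ y → bval (G x y ∧ sameSide (a x) (c y))))
    ≡⟨ Σℚ-cong m (λ x → Σℚ-cong n (λ y → bval-∧-sameSide (G x y) (a x) (c y))) ⟩
  Σℚ m (λ x → Σℚ n (λ y → bval (a x) * bval (c y) * bval (G x y) + bval (not (a x)) * bval (not (c y)) * bval (G x y)))
    ≡⟨ Σℚ-cong m (λ x → Σℚ-distrib-+ n _ _) ⟩
  Σℚ m (λ x → Σℚ n (λ y → bval (a x) * bval (c y) * bval (G x y)) + Σℚ n (λ y → bval (not (a x)) * bval (not (c y)) * bval (G x y)))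
    ≡⟨ Σℚ-distrib-+ m _ _ ⟩
  edgesBetween G (sideX side true) (sideY side true) + edgesBetween G (sideX side false) (sideY side false)
    ∎
  where
  open ≡-Reasoning
  a : Fin m → Bool
  a = side ∘ inj₁
  c : Fin n → Bool
  c = side ∘ inj₂

sameSidePairs : ∀ {m n} → (Fin m ⊎ Fin n → Bool) → ℕ
sameSidePairs {m} {n} side =
  countFin m (sideX side true)  ℕ.* countFin n (sideY side true) ℕ.+
  countFin m (sideX side false) ℕ.* countFin n (sideY side false)

sameSidePairs-bound : ∀ {m n} (side : Fin m ⊎ Fin n → Bool) →
                      sizeSide side true ℕ.≤ ⌈ m ℕ.+ n /2⌉ → sizeSide side false ℕ.≤ ⌈ m ℕ.+ n /2⌉ →
                      2 ℕ.* sameSidePairs side ℕ.≤ m ℕ.* n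
sameSidePairs-bound {m} {n} side balanced₁ balanced₂ =
  subst₂ (λ m′ n′ → 2 ℕ.* sameSidePairs side ℕ.≤ m′ ℕ.* n′) |X| |Y|
    (balanced-split {x₁} {x₂} {y₁} {y₂} (rebalance true balanced₁) (rebalance false balanced₂))
  where
  x₁ x₂ y₁ y₂ : ℕ
  x₁ = countFin m (sideX side true)
  x₂ = countFin m (sideX side false)
  y₁ = countFin n (sideY side true)
  y₂ = countFin n (sideY side false)
  |X| : x₁ ℕ.+ x₂ ≡ m
  |X| = countFin-complement m (sideX side true)
  |Y| : y₁ ℕ.+ y₂ ≡ n
  |Y| = countFin-complement n (sideY side true)
  rebalance : ∀ b → sizeSide side b ℕ.≤ ⌈ m ℕ.+ n /2⌉ →
              countFin m (sideX side b) ℕ.+ countFin n (sideY side b) ℕ.≤ ⌈ (x₁ ℕ.+ x₂) ℕ.+ (y₁ ℕ.+ y₂) /2⌉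
  rebalance b = subst₂ ℕ._≤_ (sizeSide-≡ side b) (cong ⌈_/2⌉ (sym (cong₂ ℕ._+_ |X| |Y|)))

2a≤mn⇒a/n≤m/2 : ∀ a m n → 2 ℕ.* a ℕ.≤ m ℕ.* n → ℕ→ℚ a * inv n ≤ ℕ→ℚ m * ½
2a≤mn⇒a/n≤m/2 a m zero _ = ≤-trans (≤-reflexive (*-zeroʳ (ℕ→ℚ a))) (nonNeg-* (0≤ℕ→ℚ m) 0≤½)
2a≤mn⇒a/n≤m/2 a m n@(suc _) 2a≤mn = begin
  ℕ→ℚ a * inv n                       ≡⟨ halve (ℕ→ℚ a) (inv n) ⟩
  ½ * ((+ 2 / 1) * ℕ→ℚ a) * inv n     ≡⟨ cong (λ u → ½ * u * inv n) (ℕ→ℚ-* 2 a) ⟨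
  ½ * ℕ→ℚ (2 ℕ.* a) * inv n           ≤⟨ *-monoʳ-≤-nonNeg′ (0≤inv n) (*-monoˡ-≤-nonNeg′ 0≤½ (ℕ→ℚ-mono-≤ 2a≤mn)) ⟩
  ½ * ℕ→ℚ (m ℕ.* n) * inv n           ≡⟨ cong (λ u → ½ * u * inv n) (ℕ→ℚ-* m n) ⟩
  ½ * (ℕ→ℚ m * ℕ→ℚ n) * inv n         ≡⟨ regroup (ℕ→ℚ m) (ℕ→ℚ n) (inv n) ⟩
  ℕ→ℚ m * ½ * (ℕ→ℚ n * inv n)         ≡⟨ cong (ℕ→ℚ m * ½ *_) (ℕ→ℚ-*-inv n) ⟩
  ℕ→ℚ m * ½ * 1ℚ                      ≡⟨ *-identityʳ (ℕ→ℚ m * ½) ⟩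
  ℕ→ℚ m * ½                           ∎
  where
  open ≤-Reasoning
  halve : ∀ x i → x * i ≡ ½ * ((+ 2 / 1) * x) * i
  halve = solve-∀ ℚ-ring
  regroup : ∀ x y i → ½ * (x * y) * i ≡ x * ½ * (y * i)
  regroup = solve-∀ ℚ-ring

module _ {m n} {G : BipGraph m n} {γ ε : ℚ} (extractor : IsExtractor G γ ε)
         {D : ℕ} (regular : ∀ x → degL G x ≡ D) where

  extractor-mixing : ∀ S T .{{_ : NonZero (countFin m S)}} .{{_ : NonZero D}} → γ * ℕ→ℚ m ≤ size S →
                     edgesBetween G S T ≤ size S * ℕ→ℚ D * (size T * inv n + (+ 2 / 1) * ε)
  extractor-mixing S T γm≤|S| = begin
    edgesBetween G S T
      ≡⟨ ℕ→ℚ-*-inv-cancel (countFin m S) D (edgesBetween G S T) ⟨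
    size S * ℕ→ℚ D * (inv (countFin m S) * inv D * edgesBetween G S T)
      ≡⟨ cong (size S * ℕ→ℚ D *_) (mass-∘ᴳ-uniformOn regular S T) ⟨
    size S * ℕ→ℚ D * mass T Q
      ≤⟨ *-monoˡ-≤-nonNeg′ (nonNeg-* (0≤ℕ→ℚ (countFin m S)) (0≤ℕ→ℚ D)) mass-bound ⟩
    size S * ℕ→ℚ D * (size T * inv n + (+ 2 / 1) * ε)
      ∎
    where
    open ≤-Reasoning
    Q : Fin n → ℚ
    Q = G ∘ᴳ uniformOn S
    close : dTV n Q (uniform n) ≤ ε
    close = proj₂ extractor (uniformOn S) (uniformOn-isDistribution S) (uniformOn-minEntropy S {γ} γm≤|S|)
    mass-bound : mass T Q ≤ size T * inv n + (+ 2 / 1) * ε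
    mass-bound = begin
      mass T Q                                          ≤⟨ mass-≤-dTV T Q (uniform n) ⟩
      mass T (uniform n) + (+ 2 / 1) * dTV n Q (uniform n) ≡⟨ cong (_+ (+ 2 / 1) * dTV n Q (uniform n)) (mass-uniform T) ⟩
      size T * inv n + (+ 2 / 1) * dTV n Q (uniform n)     ≤⟨ +-monoʳ-≤ (size T * inv n) (*-monoˡ-≤-nonNeg′ (0≤ℕ→ℚ 2) close) ⟩
      size T * inv n + (+ 2 / 1) * ε                       ∎

  edgesBetween-bound : 0ℚ ≤ γ → 0ℚ ≤ ε → ∀ S T →
                edgesBetween G S T ≤ size S * ℕ→ℚ D * (size T * inv n + (+ 2 / 1) * ε) + γ * ℕ→ℚ m * ℕ→ℚ D
  edgesBetween-bound 0≤γ 0≤ε S T = by-cases (size S ≤? γ * ℕ→ℚ m) (D ℕ.≟ 0)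
    where
    mixing-bound : ℚ
    mixing-bound = size S * ℕ→ℚ D * (size T * inv n + (+ 2 / 1) * ε)
    0≤mixing-bound : 0ℚ ≤ mixing-bound
    0≤mixing-bound = nonNeg-* (nonNeg-* (0≤ℕ→ℚ (countFin m S)) (0≤ℕ→ℚ D))
                              (nonNeg-+ (nonNeg-* (0≤ℕ→ℚ (countFin n T)) (0≤inv n)) (nonNeg-* (0≤ℕ→ℚ 2) 0≤ε))
    0≤γm : 0ℚ ≤ γ * ℕ→ℚ m
    0≤γm = nonNeg-* 0≤γ (0≤ℕ→ℚ m)
    by-size : size S * ℕ→ℚ D ≤ γ * ℕ→ℚ m * ℕ→ℚ D → edgesBetween G S T ≤ mixing-bound + γ * ℕ→ℚ m * ℕ→ℚ D
    by-size |S|D≤γmD = ≤-trans (edgesBetween-≤ regular S T) (≤-trans |S|D≤γmD (p≤q+p 0≤mixing-bound))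
    by-cases : Dec (size S ≤ γ * ℕ→ℚ m) → Dec (D ≡ 0) → edgesBetween G S T ≤ mixing-bound + γ * ℕ→ℚ m * ℕ→ℚ D
    by-cases (yes |S|≤γm) _         = by-size (*-monoʳ-≤-nonNeg′ (0≤ℕ→ℚ D) |S|≤γm)
    by-cases (no  _)      (yes D≡0) =
      by-size (subst (λ d → size S * ℕ→ℚ d ≤ γ * ℕ→ℚ m * ℕ→ℚ d) (sym D≡0)
                     (≤-reflexive (trans (*-zeroʳ (size S)) (sym (*-zeroʳ (γ * ℕ→ℚ m))))))
    by-cases (no  |S|≰γm) (no D≢0)  =
      ≤-trans (extractor-mixing S T {{|S|≢0}} {{ℕ.≢-nonZero D≢0}} (<⇒≤ γm<|S|)) (p≤p+q (nonNeg-* 0≤γm (0≤ℕ→ℚ D)))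
      where
      γm<|S| : γ * ℕ→ℚ m < size S
      γm<|S| = ≰⇒> |S|≰γm
      |S|≢0 : NonZero (countFin m S)
      |S|≢0 = ℕ→ℚ-pos⇒nonZero (countFin m S) (≤-<-trans 0≤γm γm<|S|)

  internalEdges-bound : 0ℚ ≤ γ → 0ℚ ≤ ε → ∀ side →
                        ℕ→ℚ (internalEdges G side)
                          ≤ ℕ→ℚ D * (ℕ→ℚ (sameSidePairs side) * inv n) + (+ 2 / 1) * (γ + ε) * (ℕ→ℚ m * ℕ→ℚ D)
  internalEdges-bound 0≤γ 0≤ε side = begin
    ℕ→ℚ (internalEdges G side)
      ≡⟨ internalEdges-split G side ⟩
    edgesBetween G (sideX side true) (sideY side true) + edgesBetween G (sideX side false) (sideY side false)
      ≤⟨ +-mono-≤ (edgesBetween-bound 0≤γ 0≤ε _ _) (edgesBetween-bound 0≤γ 0≤ε _ _) ⟩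
    (x₁ * d * (y₁ * i + (+ 2 / 1) * ε) + γ * ℕ→ℚ m * d) + (x₂ * d * (y₂ * i + (+ 2 / 1) * ε) + γ * ℕ→ℚ m * d)
      ≡⟨ regroup x₁ x₂ y₁ y₂ d i γ ε (ℕ→ℚ m) ⟩
    d * ((x₁ * y₁ + x₂ * y₂) * i) + (+ 2 / 1) * (γ * (ℕ→ℚ m * d) + ε * ((x₁ + x₂) * d))
      ≡⟨ cong₂ (λ p q → d * (p * i) + (+ 2 / 1) * (γ * (ℕ→ℚ m * d) + ε * (q * d))) pairs |X| ⟩
    d * (ℕ→ℚ (sameSidePairs side) * i) + (+ 2 / 1) * (γ * (ℕ→ℚ m * d) + ε * (ℕ→ℚ m * d))
      ≡⟨ cong (_+_ (d * (ℕ→ℚ (sameSidePairs side) * i))) (collect γ ε (ℕ→ℚ m * d)) ⟩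
    d * (ℕ→ℚ (sameSidePairs side) * i) + (+ 2 / 1) * (γ + ε) * (ℕ→ℚ m * d)
      ∎
    where
    open ≤-Reasoning
    x₁ℕ x₂ℕ y₁ℕ y₂ℕ : ℕ
    x₁ℕ = countFin m (sideX side true)
    x₂ℕ = countFin m (sideX side false)
    y₁ℕ = countFin n (sideY side true)
    y₂ℕ = countFin n (sideY side false)
    x₁ x₂ y₁ y₂ d i : ℚ
    x₁ = ℕ→ℚ x₁ℕ
    x₂ = ℕ→ℚ x₂ℕ
    y₁ = ℕ→ℚ y₁ℕ
    y₂ = ℕ→ℚ y₂ℕ
    d  = ℕ→ℚ D
    i  = inv n
    regroup : ∀ x₁ x₂ y₁ y₂ d i γ ε m →
              (x₁ * d * (y₁ * i + (+ 2 / 1) * ε) + γ * m * d) + (x₂ * d * (y₂ * i + (+ 2 / 1) * ε) + γ * m * d)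
                ≡ d * ((x₁ * y₁ + x₂ * y₂) * i) + (+ 2 / 1) * (γ * (m * d) + ε * ((x₁ + x₂) * d))
    regroup = solve-∀ ℚ-ring
    collect : ∀ γ ε e → (+ 2 / 1) * (γ * e + ε * e) ≡ (+ 2 / 1) * (γ + ε) * e
    collect = solve-∀ ℚ-ring
    pairs : x₁ * y₁ + x₂ * y₂ ≡ ℕ→ℚ (sameSidePairs side)
    pairs = sym (trans (ℕ→ℚ-+ (x₁ℕ ℕ.* y₁ℕ) (x₂ℕ ℕ.* y₂ℕ))
                       (cong₂ _+_ (ℕ→ℚ-* x₁ℕ y₁ℕ) (ℕ→ℚ-* x₂ℕ y₂ℕ)))
    |X| : x₁ + x₂ ≡ ℕ→ℚ m
    |X| = trans (sym (ℕ→ℚ-+ x₁ℕ x₂ℕ)) (cong ℕ→ℚ (countFin-complement m (sideX side true)))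

lemma4p6 : ∀ {m n : ℕ} (G : BipGraph m n) (γ ε : ℚ) →
    0ℚ ≤ γ → 0ℚ ≤ ε →
    IsExtractor G γ ε →
    IsBalanced G ((+ 4 / 1) * (γ + ε))
lemma4p6 {m} {n} G γ ε 0≤γ 0≤ε extractor@((D , _ , regular , _) , _) side balanced₁ balanced₂ = begin
  ℕ→ℚ (internalEdges G side)
    ≤⟨ internalEdges-bound extractor regular 0≤γ 0≤ε side ⟩
  ℕ→ℚ D * (ℕ→ℚ (sameSidePairs side) * inv n) + (+ 2 / 1) * (γ + ε) * (ℕ→ℚ m * ℕ→ℚ D)
    ≤⟨ +-monoˡ-≤ _ (*-monoˡ-≤-nonNeg′ (0≤ℕ→ℚ D) pairs/n≤m/2) ⟩
  ℕ→ℚ D * (ℕ→ℚ m * ½) + (+ 2 / 1) * (γ + ε) * (ℕ→ℚ m * ℕ→ℚ D)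
    ≡⟨ collect (ℕ→ℚ D) (ℕ→ℚ m) (γ + ε) ⟩
  (1ℚ + (+ 4 / 1) * (γ + ε)) * (ℕ→ℚ m * ℕ→ℚ D) * ½
    ≡⟨ cong (λ e → (1ℚ + (+ 4 / 1) * (γ + ε)) * e * ½) (numEdges-regular G regular) ⟨
  (1ℚ + (+ 4 / 1) * (γ + ε)) * ℕ→ℚ (numEdges G) * ½
    ∎
  where
  open ≤-Reasoning
  pairs/n≤m/2 : ℕ→ℚ (sameSidePairs side) * inv n ≤ ℕ→ℚ m * ½
  pairs/n≤m/2 = 2a≤mn⇒a/n≤m/2 (sameSidePairs side) m n (sameSidePairs-bound side balanced₁ balanced₂)
  collect : ∀ d m δ → d * (m * ½) + (+ 2 / 1) * δ * (m * d) ≡ (1ℚ + (+ 4 / 1) * δ) * (m * d) * ½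
  collect = solve-∀ ℚ-ring
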